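{- Let $m\ge 1$. The map $M:F^{\ast}\to D(\{0,\mathrm{n},1\}^m)$, $M(\alpha)=(\{s:V_s(\alpha)=1\},\{s:V_s(\alpha)=0\})$, is not surjective.
   Context: Kleene logic: $F^{\ast}$ is the set of formulas built from sentential variables $p_1,\dots,p_m$, the constants $0,1,\mathrm{n}$ and connectives $\neg,\wedge,\vee$. Truth values $\{0,\mathrm{n},1\}$ with $0<\mathrm{n}<1$, $\wedge=\min$, $\vee=\max$, $\neg0=1$, $\neg1=0$, $\neg\mathrm{n}=\mathrm{n}$. For a world $s\in\{0,\mathrm{n},1\}^m$, $V_s(p_i)=s_i$, constants are interpreted as themselves, and $V_s$ extends homomorphically to all formulas. For a set $S$, $D(S)=\{(A,B):A,B\subseteq S,\ A\cap B=\emptyset\}$ is the set of partial sets on $S$. -}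

module Defs where

open import Data.Nat using (ℕ)
open import Data.Fin using (Fin)
open import Data.Bool using (Bool; true; false; _∧_)
open import Data.Product using (Σ; _×_; _,_)
open import Relation.Binary.PropositionalEquality using (_≡_)

-- Kleene truth values 0 < n < 1
data K : Set where
  k0 kn k1 : K

_⊓_ : K → K → K
k0 ⊓ y = k0
kn ⊓ k0 = k0
kn ⊓ kn = kn
kn ⊓ k1 = kn
k1 ⊓ y = y

_⊔_ : K → K → K
k0 ⊔ y = y
kn ⊔ k0 = kn
kn ⊔ kn = kn
kn ⊔ k1 = k1
k1 ⊔ y = k1

neg : K → K
neg k0 = k1
neg kn = kn
neg k1 = k0

-- Formulas F* over variables p_1..p_m (indexed by Fin m)
data Form (m : ℕ) : Set where
  var  : Fin m → Form m
  c0 cn c1 : Form m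
  ¬ᶠ_  : Form m → Form m
  _∧ᶠ_ _∨ᶠ_ : Form m → Form m → Form m

World : ℕ → Set
World m = Fin m → K

V : ∀ {m} → World m → Form m → K
V s (var i)  = s i
V s c0       = k0
V s cn       = kn
V s c1       = k1
V s (¬ᶠ a)   = neg (V s a)
V s (a ∧ᶠ b) = V s a ⊓ V s b
V s (a ∨ᶠ b) = V s a ⊔ V s b

-- Subsets of a (finite) set S as characteristic functions; equality of
-- subsets is pointwise equality of characteristic functions.
Subset : Set → Set
Subset S = S → Bool

record PartialSet (S : Set) : Set where
  constructor ⟨_,_∣_⟩
  field
    pos neg' : Subset S
    disjoint : ∀ x → pos x ∧ neg' x ≡ false

isK1 : K → Bool
isK1 k1 = true
isK1 _  = false

isK0 : K → Bool
isK0 k0 = true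
isK0 _  = false

Mpos Mneg : ∀ {m} → Form m → Subset (World m)
Mpos α s = isK1 (V s α)
Mneg α s = isK0 (V s α)

_≐_ : ∀ {S : Set} → (Subset S × Subset S) → PartialSet S → Set
(A , B) ≐ P = (∀ x → A x ≡ PartialSet.pos P x) × (∀ x → B x ≡ PartialSet.neg' P x)

MSurjective : ℕ → Set
MSurjective m = ∀ (P : PartialSet (World m)) → Σ (Form m) (λ α → (Mpos α , Mneg α) ≐ P)

-- The Kleene connectives are monotone for the information order, in which n lies below 0 and 1
-- and 0, 1 are incomparable.  Hence the value of a formula can only become more defined as the
-- world does: a formula taking the value 1 at the everywhere-n world takes it at every world.
-- The partial set ({s : s₁ = n}, ∅) contains the everywhere-n world in its first component but
-- not the everywhere-0 world, so it is not of the form M(α).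
module Submission where

open import Defs
open import Data.Nat using (ℕ; _≥_; suc; s≤s)
open import Data.Fin using (zero)
open import Data.Bool using (Bool; true; false)
open import Data.Bool.Properties using (∧-zeroʳ)
open import Data.Product using (_,_)
open import Function using (const)
open import Relation.Nullary using (¬_)
open import Relation.Binary.PropositionalEquality using (_≡_; refl; trans; sym)

infix 4 _⊑_

data _⊑_ : K → K → Set where
  kn⊑  : ∀ {x} → kn ⊑ x
  ⊑-refl : ∀ {x} → x ⊑ x

neg-mono : ∀ {a b} → a ⊑ b → neg a ⊑ neg b
neg-mono kn⊑   = kn⊑
neg-mono ⊑-refl = ⊑-refl

⊓-zeroʳ : ∀ a → a ⊓ k0 ≡ k0
⊓-zeroʳ k0 = refl
⊓-zeroʳ kn = refl
⊓-zeroʳ k1 = refl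

⊔-oneʳ : ∀ a → a ⊔ k1 ≡ k1
⊔-oneʳ k0 = refl
⊔-oneʳ kn = refl
⊔-oneʳ k1 = refl

⊓-mono : ∀ {a b c d} → a ⊑ b → c ⊑ d → a ⊓ c ⊑ b ⊓ d
⊓-mono ⊑-refl ⊑-refl = ⊑-refl
⊓-mono kn⊑ kn⊑ = kn⊑
⊓-mono {b = b} kn⊑ (⊑-refl {k0}) rewrite ⊓-zeroʳ b = ⊑-refl
⊓-mono kn⊑ (⊑-refl {kn}) = kn⊑
⊓-mono kn⊑ (⊑-refl {k1}) = kn⊑
⊓-mono (⊑-refl {k0}) kn⊑ = ⊑-refl
⊓-mono (⊑-refl {kn}) kn⊑ = kn⊑
⊓-mono (⊑-refl {k1}) kn⊑ = kn⊑

⊔-mono : ∀ {a b c d} → a ⊑ b → c ⊑ d → a ⊔ c ⊑ b ⊔ d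
⊔-mono ⊑-refl ⊑-refl = ⊑-refl
⊔-mono kn⊑ kn⊑ = kn⊑
⊔-mono kn⊑ (⊑-refl {k0}) = kn⊑
⊔-mono kn⊑ (⊑-refl {kn}) = kn⊑
⊔-mono {b = b} kn⊑ (⊑-refl {k1}) rewrite ⊔-oneʳ b = ⊑-refl
⊔-mono (⊑-refl {k0}) kn⊑ = kn⊑
⊔-mono (⊑-refl {kn}) kn⊑ = kn⊑
⊔-mono (⊑-refl {k1}) kn⊑ = ⊑-refl

V-mono : ∀ {m} {s t : World m} → (∀ i → s i ⊑ t i) → ∀ α → V s α ⊑ V t α
V-mono s⊑t (var i)  = s⊑t i
V-mono s⊑t c0       = ⊑-refl
V-mono s⊑t cn       = ⊑-refl
V-mono s⊑t c1       = ⊑-refl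
V-mono s⊑t (¬ᶠ α)   = neg-mono (V-mono s⊑t α)
V-mono s⊑t (α ∧ᶠ β) = ⊓-mono (V-mono s⊑t α) (V-mono s⊑t β)
V-mono s⊑t (α ∨ᶠ β) = ⊔-mono (V-mono s⊑t α) (V-mono s⊑t β)

isK1-mono : ∀ {a b} → a ⊑ b → isK1 a ≡ true → isK1 b ≡ true
isK1-mono ⊑-refl a≡1 = a≡1

Mpos-undefined⇒Mpos : ∀ {m} (α : Form m) (s : World m) →
                      Mpos α (const kn) ≡ true → Mpos α s ≡ true
Mpos-undefined⇒Mpos α s = isK1-mono (V-mono (λ _ → kn⊑) α)

isKn : K → Bool
isKn kn = true
isKn _  = false

firstUndefined : ∀ m → PartialSet (World (suc m))
firstUndefined m = ⟨ (λ s → isKn (s zero)) , (λ _ → false) ∣ (λ s → ∧-zeroʳ (isKn (s zero))) ⟩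

mainTheorem6 : ∀ (m : ℕ) → m ≥ 1 → ¬ MSurjective m
mainTheorem6 (suc m) (s≤s _) surjective with surjective (firstUndefined m)
... | α , pos≡ , _ with trans (sym (Mpos-undefined⇒Mpos α (const k0) (pos≡ (const kn))))
                             (pos≡ (const k0))
...   | ()
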